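{- Let $\beta$ be a positive integer and let $\varphi_1$ be the CFLS coloring on $V=\{0,1\}^{\beta^2}$. There do not exist five distinct vertices $a,b,c,d,e\in V$ with $\varphi_1(a,b)=\varphi_1(b,c)=\varphi_1(c,d)$ and $\varphi_1(a,c)=\varphi_1(c,e)=\varphi_1(e,d)$.
   Context: Let $\beta$ be a positive integer and $V=\{0,1\}^{\beta^2}$. For $v\in V$ write $v=(v^{(1)},\ldots,v^{(\beta)})$ where each block $v^{(i)}\in\{0,1\}^\beta$ consists of consecutive bits of $v$. The CFLS coloring of the edges of the complete graph on $V$ is defined, for distinct $x,y\in V$, by \[\varphi_1(x,y)=\big((i,\{x^{(i)},y^{(i)}\}),\, i_1,\ldots,i_\beta\big),\] where $i$ is the first index with $x^{(i)}\neq y^{(i)}$, and for each $k=1,\ldots,\beta$, $i_k=0$ if $x^{(k)}=y^{(k)}$ and otherwise $i_k$ is the first position at which a bit of $x^{(k)}$ differs from the corresponding bit of $y^{(k)}$. -}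

module Defs where

open import Data.Nat using (ℕ; zero; suc)
open import Data.Bool using (Bool)
open import Data.Bool.Properties using () renaming (_≟_ to _≟B_)
open import Data.Fin using (Fin; zero; suc; toℕ)
open import Data.Maybe using (Maybe; just; nothing)
open import Data.Product using (_×_; _,_)
open import Data.Sum using (_⊎_)
open import Data.Vec using (Vec; []; _∷_; lookup; map; allFin)
open import Data.Vec.Properties using (≡-dec)
open import Relation.Nullary using (Dec; yes; no)
open import Relation.Binary.PropositionalEquality using (_≡_)
open import Relation.Binary.Definitions using (DecidableEquality)

Block : ℕ → Set
Block β = Vec Bool β

-- A vertex of V = {0,1}^(β²), split into β consecutive blocks of β bits:
-- v = (v^(1), …, v^(β)).
Vertex : ℕ → Set
Vertex β = Vec (Block β) β

_≟Blk_ : ∀ {β} → DecidableEquality (Block β)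
_≟Blk_ = ≡-dec _≟B_

firstDiff : ∀ {A : Set} → DecidableEquality A → ∀ {n} → Vec A n → Vec A n → Maybe (Fin n)
firstDiff _≟_ [] [] = nothing
firstDiff _≟_ (a ∷ as) (b ∷ bs) with a ≟ b
... | no _  = just zero
... | yes _ with firstDiff _≟_ as bs
...   | nothing = nothing
...   | just i  = just (suc i)

-- 1-based first differing position, 0 if the vectors are equal
firstDiffℕ : ∀ {A : Set} → DecidableEquality A → ∀ {n} → Vec A n → Vec A n → ℕ
firstDiffℕ d xs ys with firstDiff d xs ys
... | nothing = 0
... | just i  = suc (toℕ i)

-- the first component (i, x^(i), y^(i)) of the colour; the pair is stored
-- ordered here but compared as an unordered pair in _≈c_ below.
-- (nothing only arises when x = y, where φ₁ is undefined.)
record Colour (β : ℕ) : Set where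
  constructor colour
  field
    first   : Maybe (Fin β × Block β × Block β)
    indices : Vec ℕ β

-- φ₁(x,y) = ((i, {x^(i), y^(i)}), i_1, …, i_β)
φ₁ : ∀ {β} → Vertex β → Vertex β → Colour β
φ₁ x y = colour fst (map (λ k → firstDiffℕ _≟B_ (lookup x k) (lookup y k)) (allFin _))
  where
  fst : Maybe _
  fst with firstDiff _≟Blk_ x y
  ... | nothing = nothing
  ... | just i  = just (i , lookup x i , lookup y i)

data _≈f_ {β : ℕ} : Maybe (Fin β × Block β × Block β) → Maybe (Fin β × Block β × Block β) → Set where
  none≈ : nothing ≈f nothing
  same≈ : ∀ {i u v u' v'} → (u ≡ u' × v ≡ v') ⊎ (u ≡ v' × v ≡ u') →
          just (i , u , v) ≈f just (i , u' , v')

_≈c_ : ∀ {β} → Colour β → Colour β → Set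
colour f₁ is₁ ≈c colour f₂ is₂ = f₁ ≈f f₂ × is₁ ≡ is₂

-- The first component of φ₁ makes the first differing block behave like an
-- ultrametric.  Along a path x, y, z whose two edges have the same first
-- component, both edges first differ at the same block i and {x⁽ⁱ⁾,y⁽ⁱ⁾} =
-- {y⁽ⁱ⁾,z⁽ⁱ⁾} forces x⁽ⁱ⁾ = z⁽ⁱ⁾, so x and z agree up to and including block i.
-- Hence a and c first differ at some j beyond the block i where b and c (and
-- c and d) first differ; but c, e and e, d agree below j, so c and d do too,
-- contradicting i < j.
module Submission where

open import Defs
open import Data.Nat using (ℕ; NonZero; s≤s)
import Data.Nat.Properties as ℕ
open import Data.Product using (∃-syntax; _×_; _,_)
open import Data.Sum using (inj₁; inj₂)
open import Data.Maybe using (just; nothing)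
open import Data.Fin using (Fin; zero; suc; _<_; _≤_)
open import Data.Fin.Properties using (≤∧≢⇒<; ≤-antisym)
open import Data.Vec using (Vec; []; _∷_; lookup)
open import Data.Empty using (⊥-elim)
open import Relation.Nullary using (¬_; yes; no)
open import Relation.Binary.Definitions using (DecidableEquality)
open import Relation.Binary.PropositionalEquality
  using (_≡_; _≢_; ≢-sym; refl; trans; cong₂; subst₂)

module _ {A : Set} {n : ℕ} where

  record AgreeBelow (xs ys : Vec A n) (i : Fin n) : Set where
    constructor agreeBelow
    field at : ∀ m → m < i → lookup xs m ≡ lookup ys m

  record FirstDiffAt (xs ys : Vec A n) (i : Fin n) : Set where
    constructor firstDiffAt
    field
      agree   : AgreeBelow xs ys i
      differs : lookup xs i ≢ lookup ys i

  open AgreeBelow public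
  open FirstDiffAt public

  AgreeBelow-trans : ∀ {xs ys zs i} →
    AgreeBelow xs ys i → AgreeBelow ys zs i → AgreeBelow xs zs i
  AgreeBelow-trans xy yz = agreeBelow λ m m<i → trans (at xy m m<i) (at yz m m<i)

  AgreeBelow⇒≤ : ∀ {xs ys i j} → FirstDiffAt xs ys i → AgreeBelow xs ys j → j ≤ i
  AgreeBelow⇒≤ {i = i} diff agreeⱼ = ℕ.≮⇒≥ (λ i<j → differs diff (at agreeⱼ i i<j))

  AgreeThrough⇒< : ∀ {xs ys i j} → FirstDiffAt xs ys j →
    AgreeBelow xs ys i → lookup xs i ≡ lookup ys i → i < j
  AgreeThrough⇒< diff agreeᵢ xᵢ≡yᵢ =
    ≤∧≢⇒< (AgreeBelow⇒≤ diff agreeᵢ) (λ { refl → differs diff xᵢ≡yᵢ })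

  FirstDiffAt-unique : ∀ {xs ys i j} →
    FirstDiffAt xs ys i → FirstDiffAt xs ys j → i ≡ j
  FirstDiffAt-unique dᵢ dⱼ =
    ≤-antisym (AgreeBelow⇒≤ dⱼ (agree dᵢ)) (AgreeBelow⇒≤ dᵢ (agree dⱼ))

module _ {A : Set} (_≟_ : DecidableEquality A) where

  firstDiff-sound : ∀ {n} (xs ys : Vec A n) {i} →
    firstDiff _≟_ xs ys ≡ just i → FirstDiffAt xs ys i
  firstDiff-sound (x ∷ xs) (y ∷ ys) eq with x ≟ y
  firstDiff-sound (x ∷ xs) (y ∷ ys) refl | no x≢y = firstDiffAt (agreeBelow λ _ ()) x≢y
  ... | yes x≡y with firstDiff _≟_ xs ys in eqₜ
  firstDiff-sound (x ∷ xs) (y ∷ ys) refl | yes x≡y | just i =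
    firstDiffAt (agreeBelow agreeSuc) (differs tail)
    where
    tail : FirstDiffAt xs ys i
    tail = firstDiff-sound xs ys eqₜ
    agreeSuc : ∀ m → m < suc i → lookup (x ∷ xs) m ≡ lookup (y ∷ ys) m
    agreeSuc zero    _         = x≡y
    agreeSuc (suc m) (s≤s m<i) = at (agree tail) m m<i

  firstDiff-complete : ∀ {n} (xs ys : Vec A n) →
    firstDiff _≟_ xs ys ≡ nothing → xs ≡ ys
  firstDiff-complete []       []       _ = refl
  firstDiff-complete (x ∷ xs) (y ∷ ys) eq with x ≟ y
  ... | yes x≡y with firstDiff _≟_ xs ys in eqₜ
  ...   | nothing = cong₂ _∷_ x≡y (firstDiff-complete xs ys eqₜ)

module _ {β : ℕ} where

  φ₁-first : (x y : Vertex β) → x ≢ y → ∃[ i ]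
    Colour.first (φ₁ x y) ≡ just (i , lookup x i , lookup y i) × FirstDiffAt x y i
  φ₁-first x y x≢y with firstDiff _≟Blk_ x y in eq
  ... | nothing = ⊥-elim (x≢y (firstDiff-complete _≟Blk_ x y eq))
  ... | just i  = i , refl , firstDiff-sound _≟Blk_ x y eq

  sameFirstColour-path : {x y z : Vertex β} → x ≢ y → y ≢ z →
    Colour.first (φ₁ x y) ≈f Colour.first (φ₁ y z) → ∃[ i ]
    FirstDiffAt x y i × FirstDiffAt y z i × lookup x i ≡ lookup z i
  sameFirstColour-path {x} {y} {z} x≢y y≢z same
    with φ₁-first x y x≢y | φ₁-first y z y≢z
  ... | i , eqxy , dxy | _ , eqyz , dyz
    with subst₂ _≈f_ eqxy eqyz same
  ... | same≈ (inj₁ (xᵢ≡yᵢ , _)) = ⊥-elim (differs dxy xᵢ≡yᵢ)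
  ... | same≈ (inj₂ (xᵢ≡zᵢ , _)) = i , dxy , dyz , xᵢ≡zᵢ

mainTheorem5 : (β : ℕ) → .{{_ : NonZero β}} → (a b c d e : Vertex β) →
    a ≢ b → a ≢ c → a ≢ d → a ≢ e → b ≢ c → b ≢ d → b ≢ e →
    c ≢ d → c ≢ e → d ≢ e →
    ¬ ((φ₁ a b ≈c φ₁ b c) × (φ₁ b c ≈c φ₁ c d) ×
    (φ₁ a c ≈c φ₁ c e) × (φ₁ c e ≈c φ₁ e d))
mainTheorem5 β a b c d e a≢b a≢c _ _ b≢c _ _ c≢d c≢e d≢e
  ((abc , _) , (bcd , _) , (ace , _) , (ced , _))
  with sameFirstColour-path a≢b b≢c abc | sameFirstColour-path b≢c c≢d bcd
     | sameFirstColour-path a≢c c≢e ace | sameFirstColour-path c≢e (≢-sym d≢e) ced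
... | i , dab , dbc , aᵢ≡cᵢ | i′ , dbc′ , dcd , _
    | j , dac , dce , _     | j′ , dce′ , ded , _
  with FirstDiffAt-unique dbc dbc′ | FirstDiffAt-unique dce dce′
... | refl | refl = ℕ.<⇒≱ i<j j≤i
  where
  i<j : i < j
  i<j = AgreeThrough⇒< dac (AgreeBelow-trans (agree dab) (agree dbc)) aᵢ≡cᵢ
  j≤i : j ≤ i
  j≤i = AgreeBelow⇒≤ dcd (AgreeBelow-trans (agree dce) (agree ded))
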